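{- Let $\langle A;\cdot,0\rangle$ be a bounded quasi-implication algebra. Define the binary relation $\perp^M_A$ on $A\setminus\{0\}$ by $x\perp^M_A y$ iff $x\cdot(y\cdot 0)=1$. Then $\perp^M_A$ is irreflexive and symmetric on $A\setminus\{0\}$, i.e. $\langle A\setminus\{0\};\perp^M_A\rangle$ is an orthoframe.
   Context: A quasi-implication algebra is a magma $\langle A;\cdot\rangle$ satisfying, for all $x,y,z\in A$: (1) $(x\cdot y)\cdot x=x$; (2) $(x\cdot y)\cdot(x\cdot z)=(y\cdot x)\cdot(y\cdot z)$; (3) $((x\cdot y)\cdot(y\cdot x))\cdot x=((y\cdot x)\cdot(x\cdot y))\cdot y$. In any quasi-implication algebra $x\cdot x=y\cdot y$ for all $x,y$, and $1$ denotes this common element. A bounded quasi-implication algebra is a quasi-implication algebra with a distinguished element $0$ such that $0\cdot x=1$ for all $x\in A$. An orthoframe is a set equipped with an irreflexive symmetric binary relation. -}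

module Defs where

open import Level using (Level; suc; _⊔_)
open import Data.Product using (Σ; _×_; _,_)
open import Relation.Binary.PropositionalEquality using (_≡_; _≢_)
open import Relation.Binary.Core using (Rel)
open import Relation.Binary.Definitions using (Irreflexive; Symmetric)

record IsQuasiImplicationAlgebra {a : Level} {A : Set a} (_·_ : A → A → A) : Set a where
  field
    qi1 : ∀ x y → (x · y) · x ≡ x
    qi2 : ∀ x y z → (x · y) · (x · z) ≡ (y · x) · (y · z)
    qi3 : ∀ x y → ((x · y) · (y · x)) · x ≡ ((y · x) · (x · y)) · y

record BoundedQIA (a : Level) : Set (suc a) where
  field
    Carrier : Set a
    _·_     : Carrier → Carrier → Carrier
    𝟘       : Carrier
    isQIA   : IsQuasiImplicationAlgebra _·_
  -- 1 is the common value of x · x; we take 𝟘 · 𝟘 as its representative.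
  𝟙 : Carrier
  𝟙 = 𝟘 · 𝟘
  field
    bounded : ∀ x → 𝟘 · x ≡ 𝟙

IsOrthoframe : ∀ {a ℓ} (X : Set a) → Rel X ℓ → Set (a ⊔ ℓ)
IsOrthoframe X R = Irreflexive _≡_ R × Symmetric R

module _ {a : Level} (𝔸 : BoundedQIA a) where
  open BoundedQIA 𝔸

  NonZero : Set a
  NonZero = Σ Carrier (λ x → x ≢ 𝟘)

  ⊥ᴹ : Rel NonZero a
  ⊥ᴹ (x , _) (y , _) = x · (y · 𝟘) ≡ 𝟙

-- In a bounded quasi-implication algebra x ↦ x · 0 is an involutive complement,
-- 1 is a left unit, and x · (x · y) = x · y.  Irreflexivity: x · (x · 0) = 1
-- collapses to x · 0 = 1, so x = (x · 0) · 0 = 1 · 0 = 0.  Symmetry: from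
-- x · (y · 0) = 1, axiom (2) rewrites x · 0 as (y′ · x) · y with y′ = y · 0, and
-- y · (y′ · x) = 1 holds outright; so it suffices that p · q = 1 implies
-- p · (q · p) = 1, which is again axiom (2).
module Submission where

open import Level using (Level)
open import Defs
open import Data.Product using (_,_)
open import Relation.Binary.PropositionalEquality
open import Relation.Binary.Definitions using (Irreflexive; Symmetric)

module QuasiImplicationAlgebraProperties
  {a : Level} {A : Set a} {_·_ : A → A → A}
  (isQIA : IsQuasiImplicationAlgebra _·_) where

  open IsQuasiImplicationAlgebra isQIA

  ·-contractˡ : ∀ x y → x · (x · y) ≡ x · y
  ·-contractˡ x y = trans (cong (_· (x · y)) (sym (qi1 x y))) (qi1 (x · y) x)

  ·-exchange-swap : ∀ p q → (p · q) · (p · (q · p)) ≡ (q · p) · (q · p)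
  ·-exchange-swap p q = trans (qi2 p q (q · p)) (cong ((q · p) ·_) (·-contractˡ q p))

module BoundedQIAProperties {a : Level} (𝔸 : BoundedQIA a) where

  open BoundedQIA 𝔸
  open IsQuasiImplicationAlgebra isQIA
  open QuasiImplicationAlgebraProperties isQIA
  open ≡-Reasoning

  infix 30 _′
  _′ : Carrier → Carrier
  x ′ = x · 𝟘

  𝟙′≡𝟘 : 𝟙 ′ ≡ 𝟘
  𝟙′≡𝟘 = qi1 𝟘 𝟘

  ′-·-≡𝟙·𝟙 : ∀ x z → x ′ · (x · z) ≡ 𝟙 · 𝟙
  ′-·-≡𝟙·𝟙 x z = trans (qi2 x 𝟘 z) (cong₂ _·_ (bounded x) (bounded z))

  𝟙·𝟙≡𝟙 : 𝟙 · 𝟙 ≡ 𝟙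
  𝟙·𝟙≡𝟙 = begin
    𝟙 · 𝟙          ≡⟨ ′-·-≡𝟙·𝟙 𝟙 𝟘 ⟨
    𝟙 ′ · 𝟙 ′      ≡⟨ cong₂ _·_ 𝟙′≡𝟘 𝟙′≡𝟘 ⟩
    𝟙              ∎

  ′-·-≡𝟙 : ∀ x z → x ′ · (x · z) ≡ 𝟙
  ′-·-≡𝟙 x z = trans (′-·-≡𝟙·𝟙 x z) 𝟙·𝟙≡𝟙

  ·-self≡𝟙 : ∀ x → x · x ≡ 𝟙
  ·-self≡𝟙 x = begin
    x · x                        ≡⟨ cong₂ _·_ (qi1 x 𝟘) (qi1 x 𝟘) ⟨
    (x ′ · x) · (x ′ · x)        ≡⟨ qi2 x (x ′) x ⟨
    (x · x ′) · (x · x)          ≡⟨ cong (_· (x · x)) (·-contractˡ x 𝟘) ⟩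
    x ′ · (x · x)                ≡⟨ ′-·-≡𝟙 x x ⟩
    𝟙                            ∎

  𝟙-identityˡ : ∀ x → 𝟙 · x ≡ x
  𝟙-identityˡ x = trans (cong (_· x) (sym (·-self≡𝟙 x))) (qi1 x x)

  𝟙-zeroʳ : ∀ x → x · 𝟙 ≡ 𝟙
  𝟙-zeroʳ x = begin
    x · 𝟙          ≡⟨ cong (x ·_) (·-self≡𝟙 x) ⟨
    x · (x · x)    ≡⟨ ·-contractˡ x x ⟩
    x · x          ≡⟨ ·-self≡𝟙 x ⟩
    𝟙              ∎

  ′-involutive : ∀ x → x ′ ′ ≡ x
  ′-involutive x = begin
    x ′ · 𝟘                        ≡⟨ cong (_· 𝟘) (𝟙-identityˡ (x ′)) ⟨
    (𝟙 · x ′) · 𝟘                  ≡⟨ cong (λ u → (u · x ′) · 𝟘) (bounded x) ⟨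
    ((𝟘 · x) · x ′) · 𝟘            ≡⟨ qi3 x 𝟘 ⟨
    (x ′ · (𝟘 · x)) · x            ≡⟨ cong (λ u → (x ′ · u) · x) (bounded x) ⟩
    (x ′ · 𝟙) · x                  ≡⟨ cong (_· x) (𝟙-zeroʳ (x ′)) ⟩
    𝟙 · x                          ≡⟨ 𝟙-identityˡ x ⟩
    x                              ∎

  ·-≡𝟙⇒·-swap-≡𝟙 : ∀ p q → p · q ≡ 𝟙 → p · (q · p) ≡ 𝟙
  ·-≡𝟙⇒·-swap-≡𝟙 p q pq≡𝟙 = begin
    p · (q · p)                    ≡⟨ 𝟙-identityˡ _ ⟨
    𝟙 · (p · (q · p))              ≡⟨ cong (_· (p · (q · p))) pq≡𝟙 ⟨
    (p · q) · (p · (q · p))        ≡⟨ ·-exchange-swap p q ⟩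
    (q · p) · (q · p)              ≡⟨ ·-self≡𝟙 _ ⟩
    𝟙                              ∎

  ·-′-self≡𝟙⇒≡𝟘 : ∀ x → x · x ′ ≡ 𝟙 → x ≡ 𝟘
  ·-′-self≡𝟙⇒≡𝟘 x h = begin
    x              ≡⟨ ′-involutive x ⟨
    x ′ ′          ≡⟨ cong _′ (trans (sym (·-contractˡ x 𝟘)) h) ⟩
    𝟙 ′            ≡⟨ 𝟙′≡𝟘 ⟩
    𝟘              ∎

  ·-′-symmetric : ∀ x y → x · y ′ ≡ 𝟙 → y · x ′ ≡ 𝟙
  ·-′-symmetric x y x⊥y = trans (cong (y ·_) x′≡[y′·x]·y) (·-≡𝟙⇒·-swap-≡𝟙 y (y ′ · x) y·[y′·x]≡𝟙)
    where
    x′≡[y′·x]·y : x ′ ≡ (y ′ · x) · y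
    x′≡[y′·x]·y = begin
      x ′                        ≡⟨ 𝟙-identityˡ _ ⟨
      𝟙 · x ′                    ≡⟨ cong (_· x ′) x⊥y ⟨
      (x · y ′) · x ′            ≡⟨ qi2 x (y ′) 𝟘 ⟩
      (y ′ · x) · y ′ ′          ≡⟨ cong ((y ′ · x) ·_) (′-involutive y) ⟩
      (y ′ · x) · y              ∎

    y·[y′·x]≡𝟙 : y · (y ′ · x) ≡ 𝟙
    y·[y′·x]≡𝟙 = trans (cong (_· (y ′ · x)) (sym (′-involutive y))) (′-·-≡𝟙 (y ′) x)

  ⊥ᴹ-irreflexive : Irreflexive _≡_ (⊥ᴹ 𝔸)
  ⊥ᴹ-irreflexive {x , x≢𝟘} refl x⊥x = x≢𝟘 (·-′-self≡𝟙⇒≡𝟘 x x⊥x)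

  ⊥ᴹ-symmetric : Symmetric (⊥ᴹ 𝔸)
  ⊥ᴹ-symmetric {x , _} {y , _} = ·-′-symmetric x y

proposition3p4 : ∀ {a : Level} (𝔸 : BoundedQIA a) → IsOrthoframe (NonZero 𝔸) (⊥ᴹ 𝔸)
-- ⊥ᴹ ignores the proofs of x ≢ 0, so the implicit arguments of Symmetric cannot
-- be recovered by unification and are passed on by hand.
proposition3p4 𝔸 = ⊥ᴹ-irreflexive , λ {x} {y} → ⊥ᴹ-symmetric {x} {y}
  where open BoundedQIAProperties 𝔸
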